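{- Let $M$ be an o-algebra and let $N\subseteq M$. Then the following are equivalent: (1) $N = m[L]$ for some monomorphism $m:L\to M$ in $\mathbf{OFrm}$; (2) $N$ is closed under all joins and meets, and the Heyting implication.
   Context: Work in intuitionistic logic without choice. A positivity predicate on a complete lattice $L$ is a unary predicate $\mathrm{Pos}$ such that: (i) $\mathrm{Pos}(x)$ and $x\le y$ imply $\mathrm{Pos}(y)$; (ii) $\mathrm{Pos}(\bigvee X)$ implies $\mathrm{Pos}(x)$ for some $x\in X$; (iii) if $\mathrm{Pos}(x)\Rightarrow x\le y$, then $x\le y$. An o-algebra is a frame $L$ with a positivity predicate such that for all $x,y$: if $\mathrm{Pos}(z\wedge x)\Rightarrow\mathrm{Pos}(z\wedge y)$ for every $z\in L$, then $x\le y$. Write $x\bowtie y$ (overlap) for $\mathrm{Pos}(x\wedge y)$. Functions $f:L\to M$, $g:M\to L$ are symmetric if $f(x)\bowtie y\iff x\bowtie g(y)$; $f$ is symmetrizable if it has a (unique) symmetric $f^\dagger$. $\mathbf{OFrm}$ is the category of o-algebras and symmetrizable functions that preserve finite meets; equivalently, of o-algebras and open frame homomorphisms (frame homomorphisms preserving all meets and Heyting implication). $m[L]=\{m(x)\mid x\in L\}$ is the set-theoretic image. -}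

module Defs where

open import Level using (Level; _⊔_) renaming (suc to lsuc)
open import Data.Product using (Σ; ∃; _×_; _,_)
open import Relation.Binary.PropositionalEquality using (_≡_)

-- A frame (complete lattice with finite meets distributing over all joins),
-- with carrier a Set at level ℓ; joins/meets are taken over families indexed
-- by arbitrary types at level ℓ (so in particular over all subsets
-- Carrier → Set ℓ, as Σ-types). The Heyting implication is included as
-- structure (it is uniquely determined in any frame).
record Frame (ℓ : Level) : Set (lsuc ℓ) where
  infix 4 _≤_
  infixr 7 _∧_
  infixr 5 _⇒_
  field
    Carrier   : Set ℓ
    _≤_       : Carrier → Carrier → Set ℓ
    ≤-refl    : ∀ {x} → x ≤ x
    ≤-trans   : ∀ {x y z} → x ≤ y → y ≤ z → x ≤ z
    ≤-antisym : ∀ {x y} → x ≤ y → y ≤ x → x ≡ y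
    ⋁         : {I : Set ℓ} → (I → Carrier) → Carrier
    ⋁-ub      : ∀ {I : Set ℓ} (f : I → Carrier) (i : I) → f i ≤ ⋁ f
    ⋁-least   : ∀ {I : Set ℓ} (f : I → Carrier) (x : Carrier) →
                (∀ i → f i ≤ x) → ⋁ f ≤ x
    ⋀         : {I : Set ℓ} → (I → Carrier) → Carrier
    ⋀-lb      : ∀ {I : Set ℓ} (f : I → Carrier) (i : I) → ⋀ f ≤ f i
    ⋀-greatest : ∀ {I : Set ℓ} (f : I → Carrier) (x : Carrier) →
                (∀ i → x ≤ f i) → x ≤ ⋀ f
    ⊤         : Carrier
    ⊤-max     : ∀ {x} → x ≤ ⊤
    _∧_       : Carrier → Carrier → Carrier
    ∧-lb₁     : ∀ {x y} → x ∧ y ≤ x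
    ∧-lb₂     : ∀ {x y} → x ∧ y ≤ y
    ∧-greatest : ∀ {x y z} → z ≤ x → z ≤ y → z ≤ x ∧ y
    ∧-⋁-distrib : ∀ {I : Set ℓ} (x : Carrier) (f : I → Carrier) →
                x ∧ ⋁ f ≤ ⋁ (λ i → x ∧ f i)
    _⇒_       : Carrier → Carrier → Carrier
    ⇒-intro   : ∀ {x y z} → z ∧ x ≤ y → z ≤ x ⇒ y
    ⇒-elim    : ∀ {x y z} → z ≤ x ⇒ y → z ∧ x ≤ y

record OAlg (ℓ : Level) : Set (lsuc ℓ) where
  field
    frame : Frame ℓ
  open Frame frame public
  field
    Pos       : Carrier → Set ℓ
    Pos-mono  : ∀ {x y} → Pos x → x ≤ y → Pos y
    Pos-⋁     : ∀ {I : Set ℓ} (f : I → Carrier) → Pos (⋁ f) → ∃ λ i → Pos (f i)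
    Pos-pos   : ∀ {x y} → (Pos x → x ≤ y) → x ≤ y
    o-axiom   : ∀ {x y} → (∀ z → Pos (z ∧ x) → Pos (z ∧ y)) → x ≤ y

  _⋈_ : Carrier → Carrier → Set ℓ
  x ⋈ y = Pos (x ∧ y)

open OAlg

record Hom {ℓ : Level} (L M : OAlg ℓ) : Set ℓ where
  field
    fun      : Carrier L → Carrier M
    pres-⊤   : fun (⊤ L) ≡ ⊤ M
    pres-∧   : ∀ x y → fun (_∧_ L x y) ≡ _∧_ M (fun x) (fun y)
    symmetrizable : Σ (Carrier M → Carrier L) λ g →
      ∀ x y → (_⋈_ M (fun x) y → _⋈_ L x (g y)) × (_⋈_ L x (g y) → _⋈_ M (fun x) y)

open Hom

-- Monomorphism in OFrm (w.r.t. all o-algebras at the same level; morphism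
-- equality is pointwise equality of underlying functions).
IsMono : {ℓ : Level} {L M : OAlg ℓ} → Hom L M → Set (lsuc ℓ)
IsMono {ℓ} {L} {M} m =
  (K : OAlg ℓ) (h k : Hom K L) →
  (∀ z → fun m (fun h z) ≡ fun m (fun k z)) → ∀ z → fun h z ≡ fun k z

Subset : {ℓ : Level} → OAlg ℓ → Set (lsuc ℓ)
Subset {ℓ} M = Carrier M → Set ℓ

IsImage : {ℓ : Level} {L M : OAlg ℓ} → Hom L M → Subset M → Set ℓ
IsImage {L = L} m N =
  ∀ y → (N y → ∃ λ x → fun m x ≡ y) × ((∃ λ x → fun m x ≡ y) → N y)

ClosedSub : {ℓ : Level} (M : OAlg ℓ) → Subset M → Set (lsuc ℓ)
ClosedSub {ℓ} M N =
  (∀ {I : Set ℓ} (f : I → Carrier M) → (∀ i → N (f i)) → N (⋁ M f)) ×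
  (∀ {I : Set ℓ} (f : I → Carrier M) → (∀ i → N (f i)) → N (⋀ M f)) ×
  (∀ x y → N x → N y → N (_⇒_ M x y))

-- (1 ⇒ 2)  Let m : L → M be any OFrm morphism with symmetric partner g.
--   Symmetry together with the o-algebra axiom makes g left adjoint to m
--   (g y ≤ x ⟺ y ≤ m x) and gives the Frobenius law g y ∧ a ≤ g (y ∧ m a).
--   Hence m preserves all meets (as a right adjoint), all joins (by the
--   positivity axiom (ii)) and ⇒ (by Frobenius), so its image is closed
--   under these operations.
--
-- (2 ⇒ 1)  For closed N, every x has an N-hull  hull x = ⋀ {n ∈ N | x ≤ n}.
--   N contains ⊤ and is closed under ∧, so N, ordered as in M, is a frame
--   with positivity inherited from M.  The key fact is that the hull is the
--   symmetric partner of the inclusion: for n ∈ N, hull z ⋈ n implies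
--   z ⋈ n, proved by testing against the "truth value" ⟦z ⋈ n⟧ ∈ N.  This
--   yields both the o-algebra axiom for N and symmetrizability of the
--   inclusion, which is injective and hence monic with image N.
module Submission where

open import Defs
open import Level using (Level; Lift; lift)
open import Data.Bool using (Bool; true; false)
open import Data.Empty.Polymorphic using (⊥)
open import Data.Product using (Σ; _×_; _,_; proj₁; proj₂; ∃)
open import Relation.Binary.PropositionalEquality using (_≡_; refl; sym; trans; cong; subst)
open import Axiom.UniquenessOfIdentityProofs.WithK using (uip)

open Hom

module OAlgFacts {ℓ : Level} (O : OAlg ℓ) where
  open OAlg O

  ≡⇒≤ : ∀ {a b} → a ≡ b → a ≤ b
  ≡⇒≤ refl = ≤-refl

  ∧-comm-≤ : ∀ {a b} → a ∧ b ≤ b ∧ a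
  ∧-comm-≤ = ∧-greatest ∧-lb₂ ∧-lb₁

  ⋈-sym : ∀ {a b} → a ⋈ b → b ⋈ a
  ⋈-sym p = Pos-mono p ∧-comm-≤

  ⋈-mono : ∀ {a a′ b b′} → a ⋈ b → a ≤ a′ → b ≤ b′ → a′ ⋈ b′
  ⋈-mono p a≤ b≤ = Pos-mono p (∧-greatest (≤-trans ∧-lb₁ a≤) (≤-trans ∧-lb₂ b≤))

  ⋁-cong : ∀ {I : Set ℓ} (h k : I → Carrier) → (∀ i → h i ≡ k i) → ⋁ h ≡ ⋁ k
  ⋁-cong h k e = ≤-antisym
    (⋁-least h _ (λ i → ≤-trans (≡⇒≤ (e i)) (⋁-ub k i)))
    (⋁-least k _ (λ i → ≤-trans (≡⇒≤ (sym (e i))) (⋁-ub h i)))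

  ⋀-cong : ∀ {I : Set ℓ} (h k : I → Carrier) → (∀ i → h i ≡ k i) → ⋀ h ≡ ⋀ k
  ⋀-cong h k e = ≤-antisym
    (⋀-greatest k _ (λ i → ≤-trans (⋀-lb h i) (≡⇒≤ (e i))))
    (⋀-greatest h _ (λ i → ≤-trans (⋀-lb k i) (≡⇒≤ (sym (e i)))))

  ⟦_⟧ : Set ℓ → Carrier
  ⟦ p ⟧ = ⋁ {p} (λ _ → ⊤)

  Pos-⟦⟧ : ∀ {p} → Pos ⟦ p ⟧ → p
  Pos-⟦⟧ q = proj₁ (Pos-⋁ _ q)

  ≤-⟦Pos⟧ : ∀ {x} → x ≤ ⟦ Pos x ⟧
  ≤-⟦Pos⟧ = Pos-pos (λ q → ≤-trans ⊤-max (⋁-ub _ q))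

module SymmetricMorphism {ℓ : Level} {L M : OAlg ℓ} (m : Hom L M) where
  private
    module L = OAlg L
    module M = OAlg M
    module FL = OAlgFacts L
    module FM = OAlgFacts M

  f : L.Carrier → M.Carrier
  f = fun m

  g : M.Carrier → L.Carrier
  g = proj₁ (symmetrizable m)

  sym→ : ∀ x y → f x M.⋈ y → x L.⋈ g y
  sym→ x y = proj₁ (proj₂ (symmetrizable m) x y)

  sym← : ∀ x y → x L.⋈ g y → f x M.⋈ y
  sym← x y = proj₂ (proj₂ (symmetrizable m) x y)

  f-mono : ∀ {a b} → a L.≤ b → f a M.≤ f b
  f-mono {a} {b} a≤b = M.≤-trans (FM.≡⇒≤ f-a≡f-a∧b) M.∧-lb₂
    where
      a≡a∧b : a ≡ a L.∧ b
      a≡a∧b = L.≤-antisym (L.∧-greatest L.≤-refl a≤b) L.∧-lb₁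
      f-a≡f-a∧b : f a ≡ f a M.∧ f b
      f-a≡f-a∧b = trans (cong f a≡a∧b) (pres-∧ m a b)

  g-mono : ∀ {a b} → a M.≤ b → g a L.≤ g b
  g-mono {a} {b} a≤b = L.o-axiom λ z p →
    sym→ z b (FM.⋈-mono (sym← z a p) M.≤-refl a≤b)

  -- g preserves positivity: test against ⊤, which m preserves.
  g-Pos : ∀ {w} → M.Pos w → L.Pos (g w)
  g-Pos {w} p = L.Pos-mono (sym→ L.⊤ w ⊤⋈w) L.∧-lb₂
    where
      ⊤⋈w : f L.⊤ M.⋈ w
      ⊤⋈w = subst (λ t → t M.⋈ w) (sym (pres-⊤ m))
                  (M.Pos-mono p (M.∧-greatest M.⊤-max M.≤-refl))

  ≤f⇒g≤ : ∀ {x y} → y M.≤ f x → g y L.≤ x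
  ≤f⇒g≤ {x} {y} y≤fx = L.o-axiom λ z p →
    let fz⋈fx  = FM.⋈-mono (sym← z y p) M.≤-refl y≤fx
        fz∧x⋈⊤ = subst (λ t → t M.⋈ M.⊤) (sym (pres-∧ m z x))
                       (M.Pos-mono fz⋈fx (M.∧-greatest M.≤-refl M.⊤-max))
    in L.Pos-mono (sym→ (z L.∧ x) M.⊤ fz∧x⋈⊤) L.∧-lb₁

  g≤⇒≤f : ∀ {x y} → g y L.≤ x → y M.≤ f x
  g≤⇒≤f {x} {y} gy≤x = M.o-axiom λ z p →
    FM.⋈-sym (sym← x z (L.Pos-mono (g-Pos p)
      (L.∧-greatest (L.≤-trans (g-mono M.∧-lb₂) gy≤x) (g-mono M.∧-lb₁))))

  frobenius : ∀ {y a} → g y L.∧ a L.≤ g (y M.∧ f a)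
  frobenius {y} {a} = L.o-axiom λ z p →
    let z∧a⋈gy  = L.Pos-mono p (L.∧-greatest
                    (L.∧-greatest L.∧-lb₁ (L.≤-trans L.∧-lb₂ L.∧-lb₂)) (L.≤-trans L.∧-lb₂ L.∧-lb₁))
        fz∧fa⋈y = subst (λ t → t M.⋈ y) (pres-∧ m z a) (sym← (z L.∧ a) y z∧a⋈gy)
    in sym→ z (y M.∧ f a) (M.Pos-mono fz∧fa⋈y
         (M.∧-greatest (M.≤-trans M.∧-lb₁ M.∧-lb₁) (M.∧-greatest M.∧-lb₂ (M.≤-trans M.∧-lb₁ M.∧-lb₂))))

  -- A right adjoint preserves all meets.
  pres-⋀ : ∀ {I : Set ℓ} (h : I → L.Carrier) → f (L.⋀ h) ≡ M.⋀ (λ i → f (h i))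
  pres-⋀ h = M.≤-antisym
    (M.⋀-greatest _ _ (λ i → f-mono (L.⋀-lb h i)))
    (g≤⇒≤f (L.⋀-greatest h _ (λ i → ≤f⇒g≤ (M.⋀-lb _ i))))

  -- Joins are preserved because positivity detects which summand overlaps.
  pres-⋁ : ∀ {I : Set ℓ} (h : I → L.Carrier) → f (L.⋁ h) ≡ M.⋁ (λ i → f (h i))
  pres-⋁ h = M.≤-antisym
    (M.o-axiom λ z p →
      let ⋁h⋈gz       = sym→ (L.⋁ h) z (FM.⋈-sym p)
          (i , gz⋈hi) = L.Pos-⋁ _ (L.Pos-mono (FL.⋈-sym ⋁h⋈gz) (L.∧-⋁-distrib _ h))
      in FM.⋈-mono (g⋈⇒⋈f gz⋈hi) M.≤-refl (M.⋁-ub _ i))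
    (M.⋁-least _ _ (λ i → f-mono (L.⋁-ub h i)))
    where
      g⋈⇒⋈f : ∀ {x z} → g z L.⋈ x → z M.⋈ f x
      g⋈⇒⋈f {x} {z} q = FM.⋈-sym (sym← x z (FL.⋈-sym q))

  pres-⇒ : ∀ a b → f (a L.⇒ b) ≡ (f a M.⇒ f b)
  pres-⇒ a b = M.≤-antisym
    (M.⇒-intro (M.≤-trans (FM.≡⇒≤ (sym (pres-∧ m (a L.⇒ b) a))) (f-mono (L.⇒-elim L.≤-refl))))
    (g≤⇒≤f (L.⇒-intro (L.≤-trans frobenius
      (L.≤-trans (g-mono (M.⇒-elim M.≤-refl)) (≤f⇒g≤ M.≤-refl)))))

  image-closed : (N : Subset M) → IsImage m N → ClosedSub M N
  image-closed N img = closed-⋁ , closed-⋀ , closed-⇒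
    where
      preimage : ∀ {y} → N y → ∃ λ x → f x ≡ y
      preimage n = proj₁ (img _) n

      closed-⋁ : ∀ {I : Set ℓ} (h : I → M.Carrier) → (∀ i → N (h i)) → N (M.⋁ h)
      closed-⋁ h nh = proj₂ (img _)
        (L.⋁ xs , trans (pres-⋁ xs) (FM.⋁-cong _ h (λ i → proj₂ (preimage (nh i)))))
        where xs = λ i → proj₁ (preimage (nh i))

      closed-⋀ : ∀ {I : Set ℓ} (h : I → M.Carrier) → (∀ i → N (h i)) → N (M.⋀ h)
      closed-⋀ h nh = proj₂ (img _)
        (L.⋀ xs , trans (pres-⋀ xs) (FM.⋀-cong _ h (λ i → proj₂ (preimage (nh i)))))
        where xs = λ i → proj₁ (preimage (nh i))

      closed-⇒ : ∀ x y → N x → N y → N (x M.⇒ y)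
      closed-⇒ x y nx ny with preimage nx | preimage ny
      ... | a , refl | b , refl = proj₂ (img _) (a L.⇒ b , pres-⇒ a b)

module ClosedSubalgebra {ℓ : Level} (M : OAlg ℓ) (N : Subset M) (closed : ClosedSub M N) where
  private
    module M = OAlg M
    module FM = OAlgFacts M
  open FM using (⟦_⟧)

  closed-⋁ : ∀ {I : Set ℓ} (h : I → M.Carrier) → (∀ i → N (h i)) → N (M.⋁ h)
  closed-⋁ = proj₁ closed

  closed-⋀ : ∀ {I : Set ℓ} (h : I → M.Carrier) → (∀ i → N (h i)) → N (M.⋀ h)
  closed-⋀ = proj₁ (proj₂ closed)

  closed-⇒ : ∀ x y → N x → N y → N (x M.⇒ y)
  closed-⇒ = proj₂ (proj₂ closed)

  -- ⊤ is the empty meet and a ∧ b the meet of a two-element family.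
  N-⊤ : N M.⊤
  N-⊤ = subst N (M.≤-antisym M.⊤-max (M.⋀-greatest _ _ (λ ()))) (closed-⋀ {⊥} (λ ()) (λ ()))

  N-∧ : ∀ {a b} → N a → N b → N (a M.∧ b)
  N-∧ {a} {b} na nb = subst N ⋀pair≡a∧b (closed-⋀ pair N-pair)
    where
      pair : Lift ℓ Bool → M.Carrier
      pair (lift true)  = a
      pair (lift false) = b
      N-pair : ∀ i → N (pair i)
      N-pair (lift true)  = na
      N-pair (lift false) = nb
      ⋀pair≡a∧b : M.⋀ pair ≡ a M.∧ b
      ⋀pair≡a∧b = M.≤-antisym
        (M.∧-greatest (M.⋀-lb pair (lift true)) (M.⋀-lb pair (lift false)))
        (M.⋀-greatest pair _ λ { (lift true) → M.∧-lb₁ ; (lift false) → M.∧-lb₂ })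

  N-⟦⟧ : ∀ p → N ⟦ p ⟧
  N-⟦⟧ p = closed-⋁ _ (λ _ → N-⊤)

  hull : M.Carrier → M.Carrier
  hull x = M.⋀ {Σ M.Carrier λ n → N n × x M.≤ n} proj₁

  N-hull : ∀ x → N (hull x)
  N-hull x = closed-⋀ proj₁ (λ i → proj₁ (proj₂ i))

  ≤-hull : ∀ x → x M.≤ hull x
  ≤-hull x = M.⋀-greatest proj₁ x (λ i → proj₂ (proj₂ i))

  hull-least : ∀ {x n} → N n → x M.≤ n → hull x M.≤ n
  hull-least {n = n} nn x≤n = M.⋀-lb proj₁ (n , nn , x≤n)

  hull-fixes-N : ∀ {x} → N x → hull x ≡ x
  hull-fixes-N {x} nx = M.≤-antisym (hull-least nx M.≤-refl) (≤-hull x)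

  -- Key lemma: against elements of N, hull z overlaps no more than z.
  -- Since n ⇒ ⟦z ⋈ n⟧ lies in N and is above z, it is above hull z.
  hull-⋈ : ∀ {z n} → N n → hull z M.⋈ n → z M.⋈ n
  hull-⋈ {z} {n} nn p = FM.Pos-⟦⟧ (M.Pos-mono p (M.⇒-elim hull≤n⇒⟦z⋈n⟧))
    where
      hull≤n⇒⟦z⋈n⟧ : hull z M.≤ (n M.⇒ ⟦ z M.⋈ n ⟧)
      hull≤n⇒⟦z⋈n⟧ = hull-least (closed-⇒ _ _ nn (N-⟦⟧ _)) (M.⇒-intro FM.≤-⟦Pos⟧)

  -- Elements of N, represented as hull-fixed points so that equality of
  -- elements is equality in M (proofs of hull x ≡ x are unique).
  Elt : Set ℓ
  Elt = Σ M.Carrier λ x → hull x ≡ x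

  elt : ∀ {x} → N x → Elt
  elt {x} nx = x , hull-fixes-N nx

  N-elt : (a : Elt) → N (proj₁ a)
  N-elt (x , hx≡x) = subst N hx≡x (N-hull x)

  Elt-≡ : {a b : Elt} → proj₁ a ≡ proj₁ b → a ≡ b
  Elt-≡ {x , p} {.x , q} refl = cong (x ,_) (uip p q)

  frame′ : Frame ℓ
  frame′ = record
    { Carrier     = Elt
    ; _≤_         = λ a b → proj₁ a M.≤ proj₁ b
    ; ≤-refl      = M.≤-refl
    ; ≤-trans     = M.≤-trans
    ; ≤-antisym   = λ a≤b b≤a → Elt-≡ (M.≤-antisym a≤b b≤a)
    ; ⋁           = λ h → elt (closed-⋁ _ (λ i → N-elt (h i)))
    ; ⋁-ub        = λ h i → M.⋁-ub _ i
    ; ⋁-least     = λ h x ≤x → M.⋁-least _ _ ≤x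
    ; ⋀           = λ h → elt (closed-⋀ _ (λ i → N-elt (h i)))
    ; ⋀-lb        = λ h i → M.⋀-lb _ i
    ; ⋀-greatest  = λ h x x≤ → M.⋀-greatest _ _ x≤
    ; ⊤           = elt N-⊤
    ; ⊤-max       = M.⊤-max
    ; _∧_         = λ a b → elt (N-∧ (N-elt a) (N-elt b))
    ; ∧-lb₁       = M.∧-lb₁
    ; ∧-lb₂       = M.∧-lb₂
    ; ∧-greatest  = M.∧-greatest
    ; ∧-⋁-distrib = λ x h → M.∧-⋁-distrib _ _
    ; _⇒_         = λ a b → elt (closed-⇒ _ _ (N-elt a) (N-elt b))
    ; ⇒-intro     = M.⇒-intro
    ; ⇒-elim      = M.⇒-elim
    }

  hull′ : M.Carrier → Elt
  hull′ z = elt (N-hull z)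

  -- Positivity is inherited; the o-algebra axiom follows from that of M
  -- by testing only against hulls, using hull-⋈.
  sub : OAlg ℓ
  sub = record
    { frame    = frame′
    ; Pos      = λ a → M.Pos (proj₁ a)
    ; Pos-mono = M.Pos-mono
    ; Pos-⋁    = λ h p → M.Pos-⋁ _ p
    ; Pos-pos  = M.Pos-pos
    ; o-axiom  = λ {a} {b} test → M.o-axiom λ z z⋈a →
        hull-⋈ (N-elt b) (test (hull′ z) (FM.⋈-mono z⋈a (≤-hull z) M.≤-refl))
    }

  inclusion : Hom sub M
  inclusion = record
    { fun           = proj₁
    ; pres-⊤        = refl
    ; pres-∧        = λ a b → refl
    ; symmetrizable = hull′ , λ a y →
        (λ a⋈y → FM.⋈-mono a⋈y M.≤-refl (≤-hull y))
      , (λ a⋈hy → FM.⋈-sym (hull-⋈ (N-elt a) (FM.⋈-sym a⋈hy)))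
    }

  inclusion-mono : IsMono inclusion
  inclusion-mono K h k e z = Elt-≡ (e z)

  inclusion-image : IsImage inclusion N
  inclusion-image y = (λ ny → elt ny , refl) , λ { (a , refl) → N-elt a }

proposition5p3 : {ℓ : Level} (M : OAlg ℓ) (N : Subset M) →
    ((Σ (OAlg ℓ) λ L → Σ (Hom L M) λ m → IsMono m × IsImage m N) → ClosedSub M N) ×
    (ClosedSub M N → Σ (OAlg ℓ) λ L → Σ (Hom L M) λ m → IsMono m × IsImage m N)
proposition5p3 M N = image⇒closed , closed⇒image
  where
    image⇒closed : (Σ (OAlg _) λ L → Σ (Hom L M) λ m → IsMono m × IsImage m N) → ClosedSub M N
    image⇒closed (L , m , _ , img) = SymmetricMorphism.image-closed m N img

    closed⇒image : ClosedSub M N → Σ (OAlg _) λ L → Σ (Hom L M) λ m → IsMono m × IsImage m N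
    closed⇒image closed = sub , inclusion , inclusion-mono , inclusion-image
      where open ClosedSubalgebra M N closed
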